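{- Let $q$ be an odd prime. Then \[ \bigl\{ r \bmod \pi(q) : \exists \text{ prime } p \equiv 1 \pmod{q} \text{ with } z(p) \mid \gcd(r, \pi(q)) \bigr\} \subseteq S(q). \] In particular, $S(q) \neq \emptyset$ whenever there exists a prime $p \equiv 1 \pmod{q}$ with $z(p) \mid \pi(q)$.
   Context: $F_n$ denotes the $n$-th Fibonacci number ($F_0=0$, $F_1=1$, $F_n=F_{n-1}+F_{n-2}$) and $\varphi$ is Euler's totient function. For a prime $p$, the rank of apparition $z(p)$ is the smallest positive integer $k$ with $p \mid F_k$. For a positive integer $n$, the Pisano period $\pi(n)$ is the period of the sequence $(F_m \bmod n)_{m\ge 0}$. For an odd prime $q$, $S(q)$ is the set of residue classes $r \bmod \pi(q)$ such that $q \mid \varphi(F_m)$ for every positive integer $m \equiv r \pmod{\pi(q)}$. -}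

module Defs where

open import Data.Nat using (ℕ; zero; suc; _+_; _*_; _<_; _≤_)
open import Data.Nat.Divisibility using (_∣_)
open import Data.Nat.Coprimality using (coprime?)
open import Data.List using (length; filter; map; upTo)
open import Data.Integer as ℤ using (+_; _-_)
import Data.Integer.Divisibility as ℤDiv
open import Data.Product using (_×_)
open import Relation.Binary.PropositionalEquality using (_≡_)

F : ℕ → ℕ
F zero = zero
F (suc zero) = suc zero
F (suc (suc n)) = F (suc n) + F n

φ : ℕ → ℕ
φ n = length (filter (λ k → coprime? k n) (map suc (upTo n)))

_≡_[mod_] : ℕ → ℕ → ℕ → Set
a ≡ b [mod n ] = (+ n) ℤDiv.∣ ((+ a) - (+ b))

IsRankOfApparition : ℕ → ℕ → Set
IsRankOfApparition p k =
  0 < k × p ∣ F k × (∀ j → 0 < j → p ∣ F j → k ≤ j)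

IsPisanoPeriod : ℕ → ℕ → Set
IsPisanoPeriod n P =
  0 < P × (∀ m → F (m + P) ≡ F m [mod n ]) ×
  (∀ Q → 0 < Q → (∀ m → F (m + Q) ≡ F m [mod n ]) → P ≤ Q)

-- r (a representative of a class mod P = π(q)) lies in S(q):
-- q ∣ φ(F m) for every positive m ≡ r (mod P)
InS : (q P r : ℕ) → Set
InS q P r = ∀ m → 0 < m → m ≡ r [mod P ] → q ∣ φ (F m)

{-# OPTIONS --safe #-}
-- If z(p) ∣ gcd(r, π(q)) and m ≡ r (mod π(q)), then z(p) ∣ m, so p ∣ F z(p) ∣ F m because
-- the Fibonacci numbers form a divisibility sequence. A prime p dividing n > 0 has
-- p − 1 ∣ φ(n): φ(p·m) = p·φ(m) when p ∣ m, and φ(p·m) = (p − 1)·φ(m) otherwise, since the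
-- p·φ(m) integers in [1, p·m] coprime to m include exactly φ(m) multiples of p, namely the
-- j·p with j coprime to m; induction on m does the rest. Finally q ∣ p − 1.
module Submission where

open import Defs
open import Data.Bool using (Bool; true; false; if_then_else_; _∧_; not)
open import Data.Bool.Properties using (∧-zeroʳ; ∧-identityʳ)
import Data.Integer as ℤ
import Data.Integer.Properties as ℤ
import Data.Integer.Divisibility.Signed as Signed
open import Data.List using (length; filter; applyUpTo)
open import Data.List.Properties using (map-applyUpTo)
open import Data.Nat
open import Data.Nat.Coprimality using (Coprime; coprime?; coprime-+; coprime-divisor)
import Data.Nat.Coprimality as Coprime
open import Data.Nat.Divisibility
open import Data.Nat.GCD using (gcd; gcd[m,n]∣m; gcd[m,n]∣n; gcd-identityˡ)
open import Data.Nat.Induction using (<-rec)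
open import Data.Nat.Primality using (Prime; prime⇒irreducible; prime⇒nonZero; prime⇒nonTrivial)
open import Data.Nat.Properties
open import Data.Nat.Tactic.RingSolver using (solve-∀)
open import Data.Product using (_×_; _,_; ∃)
open import Data.Sum using (inj₁; inj₂)
open import Function using (_∘_; id; _⇔_; mk⇔)
open import Relation.Nullary using (¬_; yes; no; does; contradiction)
open import Relation.Nullary.Decidable using (does-⇔; dec-true; dec-false; _×-dec_; ¬?)
open import Relation.Unary using (Decidable)
open import Relation.Binary.PropositionalEquality

private
  variable
    a b d j m n p x : ℕ

indicator : Bool → ℕ
indicator b = if b then 1 else 0

-- Counts the k with 1 ≤ k ≤ n (not 0 ≤ k < n), to match the range in φ.
count : (ℕ → Bool) → ℕ → ℕ
count Q zero    = 0
count Q (suc n) = indicator (Q 1) + count (Q ∘ suc) n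

count-cong : ∀ {Q R} n → (∀ k → Q k ≡ R k) → count Q n ≡ count R n
count-cong zero    Q≗R = refl
count-cong (suc n) Q≗R =
  cong₂ _+_ (cong indicator (Q≗R 1)) (count-cong n (Q≗R ∘ suc))

count-+ : ∀ Q m n → count Q (m + n) ≡ count Q m + count (Q ∘ (m +_)) n
count-+ Q zero    n = refl
count-+ Q (suc m) n =
  trans (cong (_ +_) (count-+ (Q ∘ suc) m n)) (sym (+-assoc (indicator (Q 1)) _ _))

count-periodic : ∀ Q m → (∀ k → Q (m + k) ≡ Q k) → ∀ p → count Q (p * m) ≡ p * count Q m
count-periodic Q m periodic zero    = refl
count-periodic Q m periodic (suc p) = begin
  count Q (m + p * m)                     ≡⟨ count-+ Q m (p * m) ⟩
  count Q m + count (Q ∘ (m +_)) (p * m)  ≡⟨ cong (count Q m +_) (count-cong (p * m) periodic) ⟩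
  count Q m + count Q (p * m)             ≡⟨ cong (count Q m +_) (count-periodic Q m periodic p) ⟩
  count Q m + p * count Q m               ∎
  where open ≡-Reasoning

count-split : ∀ Q R n →
  count Q n ≡ count (λ k → Q k ∧ R k) n + count (λ k → Q k ∧ not (R k)) n
count-split Q R zero = refl
count-split Q R (suc n) with Q 1 | R 1 | count-split (Q ∘ suc) (R ∘ suc) n
... | false | _     | ih = ih
... | true  | true  | ih = cong suc ih
... | true  | false | ih = trans (cong suc ih) (sym (+-suc _ _))

count-last : ∀ Q n → (∀ k → k < n → Q (suc k) ≡ false) →
  count Q (suc n) ≡ indicator (Q (suc n))
count-last Q zero    _      = +-identityʳ _
count-last Q (suc n) vanish rewrite vanish 0 z<s =
  count-last (Q ∘ suc) n (λ k k<n → vanish (suc k) (s<s k<n))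

count-multiples : ∀ Q p m → .{{NonZero p}} → (∀ k → ¬ p ∣ k → Q k ≡ false) →
  count Q (m * p) ≡ count (λ j → Q (j * p)) m
count-multiples Q p zero    vanish = refl
count-multiples Q p@(suc p′) (suc m) vanish = begin
  count Q (p + m * p)                        ≡⟨ count-+ Q p (m * p) ⟩
  count Q p + count (Q ∘ (p +_)) (m * p)     ≡⟨ cong₂ _+_ (count-last Q p′ below-p)
                                                  (count-multiples (Q ∘ (p +_)) p m vanish-shifted) ⟩
  indicator (Q p) + count (λ j → Q (p + j * p)) m
    ≡⟨ cong (λ i → indicator (Q i) + count (λ j → Q (p + j * p)) m) (*-identityˡ p) ⟨
  count (λ j → Q (j * p)) (suc m)            ∎
  where
  open ≡-Reasoning
  below-p : ∀ k → k < p′ → Q (suc k) ≡ false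
  below-p k k<p′ = vanish (suc k) (λ p∣1+k → <⇒≱ (s<s k<p′) (∣⇒≤ p∣1+k))
  vanish-shifted : ∀ k → ¬ p ∣ k → Q (p + k) ≡ false
  vanish-shifted k p∤k = vanish (p + k) (λ p∣p+k → p∤k (∣m+n∣m⇒∣n p∣p+k ∣-refl))

length-filter-applyUpTo : ∀ {P : ℕ → Set} (P? : Decidable P) f n →
  length (filter P? (applyUpTo (f ∘ suc) n)) ≡ count (λ k → does (P? (f k))) n
length-filter-applyUpTo P? f zero = refl
length-filter-applyUpTo P? f (suc n) with does (P? (f 1))
... | true  = cong suc (length-filter-applyUpTo P? (f ∘ suc) n)
... | false = length-filter-applyUpTo P? (f ∘ suc) n

coprimeTo : ℕ → ℕ → Bool
coprimeTo n k = does (coprime? k n)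

φ-count : ∀ n → φ n ≡ count (coprimeTo n) n
φ-count n = trans (cong (length ∘ filter (λ k → coprime? k n)) (map-applyUpTo id suc n))
                  (length-filter-applyUpTo (λ k → coprime? k n) id n)

coprime-+⁻¹ : Coprime (n + m) n → Coprime m n
coprime-+⁻¹ c (d∣m , d∣n) = c (∣m∣n⇒∣m+n d∣n d∣m , d∣n)

coprime-∣ˡ : d ∣ m → Coprime m n → Coprime d n
coprime-∣ˡ d∣m c (e∣d , e∣n) = c (∣-trans e∣d d∣m , e∣n)

prime∤⇒coprime : Prime p → ¬ p ∣ n → Coprime n p
prime∤⇒coprime p-prime p∤n (d∣n , d∣p) with prime⇒irreducible p-prime d∣p
... | inj₁ d≡1 = d≡1
... | inj₂ refl = contradiction d∣n p∤n

count-coprimeTo-* : ∀ p m → count (coprimeTo m) (p * m) ≡ p * φ m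
count-coprimeTo-* p m = begin
  count (coprimeTo m) (p * m) ≡⟨ count-periodic (coprimeTo m) m periodic p ⟩
  p * count (coprimeTo m) m   ≡⟨ cong (p *_) (φ-count m) ⟨
  p * φ m                     ∎
  where
  open ≡-Reasoning
  periodic : ∀ k → coprimeTo m (m + k) ≡ coprimeTo m k
  periodic k = does-⇔ (mk⇔ coprime-+⁻¹ coprime-+) (coprime? (m + k) m) (coprime? k m)

coprime-*-∣ : p ∣ m → Coprime x (p * m) ⇔ Coprime x m
coprime-*-∣ {p} {m} p∣m = mk⇔
  (λ c {_} (d∣x , d∣m) → c (d∣x , ∣n⇒∣m*n p d∣m))
  (λ c {d} (d∣x , d∣p*m) →
    c (d∣x , ∣-trans (coprime-divisor (coprime-∣ˡ d∣x c) (subst (d ∣_) (*-comm p m) d∣p*m)) p∣m))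

φ-*-∣ : p ∣ m → φ (p * m) ≡ p * φ m
φ-*-∣ {p} {m} p∣m = begin
  φ (p * m)                          ≡⟨ φ-count (p * m) ⟩
  count (coprimeTo (p * m)) (p * m)  ≡⟨ count-cong (p * m) same-coprimes ⟩
  count (coprimeTo m) (p * m)        ≡⟨ count-coprimeTo-* p m ⟩
  p * φ m                            ∎
  where
  open ≡-Reasoning
  same-coprimes : ∀ k → coprimeTo (p * m) k ≡ coprimeTo m k
  same-coprimes k = does-⇔ (coprime-*-∣ p∣m) (coprime? k (p * m)) (coprime? k m)

coprime-prime-* : Prime p → Coprime x (p * m) ⇔ (Coprime x m × ¬ p ∣ x)
coprime-prime-* {p} {x} {m} p-prime = mk⇔
  (λ c → (λ {_} (d∣x , d∣m) → c (d∣x , ∣n⇒∣m*n p d∣m)) ,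
         (λ p∣x → nonTrivial⇒≢1 {{prime⇒nonTrivial p-prime}} (c (p∣x , m∣m*n m))))
  (λ (c , p∤x) {_} (d∣x , d∣p*m) →
    c (d∣x , coprime-divisor (coprime-∣ˡ d∣x (prime∤⇒coprime p-prime p∤x)) d∣p*m))

coprime-*ʳ : Coprime p m → Coprime (j * p) m ⇔ Coprime j m
coprime-*ʳ {p} {m} {j} p⊥m = mk⇔
  (λ c {_} (d∣j , d∣m) → c (∣m⇒∣m*n p d∣j , d∣m))
  (λ c {e} (e∣j*p , e∣m) →
    c (coprime-divisor (coprime-∣ˡ e∣m (Coprime.sym p⊥m)) (subst (e ∣_) (*-comm j p) e∣j*p) , e∣m))

count-coprimeTo-multiples : ∀ p m → .{{NonZero p}} → Coprime p m →
  count (λ k → coprimeTo m k ∧ does (p ∣? k)) (p * m) ≡ φ m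
count-coprimeTo-multiples p m p⊥m = begin
  count Q (p * m)                    ≡⟨ cong (count Q) (*-comm p m) ⟩
  count Q (m * p)                    ≡⟨ count-multiples Q p m off-multiples ⟩
  count (λ j → Q (j * p)) m          ≡⟨ count-cong m on-multiples ⟩
  count (coprimeTo m) m              ≡⟨ φ-count m ⟨
  φ m                                ∎
  where
  open ≡-Reasoning
  Q : ℕ → Bool
  Q k = coprimeTo m k ∧ does (p ∣? k)
  off-multiples : ∀ k → ¬ p ∣ k → Q k ≡ false
  off-multiples k p∤k = trans (cong (coprimeTo m k ∧_) (dec-false (p ∣? k) p∤k)) (∧-zeroʳ _)
  on-multiples : ∀ j → Q (j * p) ≡ coprimeTo m j
  on-multiples j =
    trans (cong₂ _∧_ (does-⇔ (coprime-*ʳ p⊥m) (coprime? (j * p) m) (coprime? j m))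
                     (dec-true (p ∣? j * p) (n∣m*n j)))
          (∧-identityʳ _)

φ-*-prime∤ : Prime p → ¬ p ∣ m → φ (p * m) ≡ (p ∸ 1) * φ m
φ-*-prime∤ {p} {m} p-prime p∤m = begin
  φ (p * m)                  ≡⟨ m+n∸m≡n (φ m) _ ⟨
  φ m + φ (p * m) ∸ φ m      ≡⟨ cong (_∸ φ m) split ⟩
  p * φ m ∸ φ m              ≡⟨ cong (p * φ m ∸_) (*-identityˡ (φ m)) ⟨
  p * φ m ∸ 1 * φ m          ≡⟨ *-distribʳ-∸ (φ m) p 1 ⟨
  (p ∸ 1) * φ m              ∎
  where
  open ≡-Reasoning
  instance _ = prime⇒nonZero p-prime
  A B : ℕ → Bool
  A = coprimeTo m
  B k = does (p ∣? k)
  split : φ m + φ (p * m) ≡ p * φ m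
  split = begin
    φ m + φ (p * m)
      ≡⟨ cong₂ _+_ (sym (count-coprimeTo-multiples p m (Coprime.sym (prime∤⇒coprime p-prime p∤m))))
                   (trans (φ-count (p * m)) (count-cong (p * m) coprime-to-p*m)) ⟩
    count (λ k → A k ∧ B k) (p * m) + count (λ k → A k ∧ not (B k)) (p * m)
      ≡⟨ count-split A B (p * m) ⟨
    count A (p * m)
      ≡⟨ count-coprimeTo-* p m ⟩
    p * φ m ∎
    where
    coprime-to-p*m : ∀ k → coprimeTo (p * m) k ≡ A k ∧ not (B k)
    coprime-to-p*m k =
      does-⇔ (coprime-prime-* p-prime) (coprime? k (p * m)) (coprime? k m ×-dec ¬? (p ∣? k))

p∸1∣φ[p*m] : Prime p → ∀ m → .{{NonZero m}} → p ∸ 1 ∣ φ (p * m)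
p∸1∣φ[p*m] {p} p-prime = <-rec (λ m → .{{NonZero m}} → p ∸ 1 ∣ φ (p * m)) step
  where
  step : ∀ m → (∀ {k} → k < m → .{{NonZero k}} → p ∸ 1 ∣ φ (p * k)) →
         .{{NonZero m}} → p ∸ 1 ∣ φ (p * m)
  step m ih with p ∣? m
  ... | no p∤m = subst (p ∸ 1 ∣_) (sym (φ-*-prime∤ p-prime p∤m)) (m∣m*n (φ m))
  ... | yes (divides k refl) =
    subst (p ∸ 1 ∣_) (sym (φ-*-∣ {p} {k * p} (n∣m*n k)))
      (∣n⇒∣m*n p (subst (λ n → p ∸ 1 ∣ φ n) (*-comm p k) (ih k<k*p)))
    where
    instance
      _ = m*n≢0⇒m≢0 k
      _ = prime⇒nonTrivial p-prime
    k<k*p : k < k * p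
    k<k*p = m<m*n k p (nonTrivial⇒n>1 p)

prime∣n⇒p∸1∣φ[n] : Prime p → p ∣ n → .{{NonZero n}} → p ∸ 1 ∣ φ n
prime∣n⇒p∸1∣φ[n] {p} p-prime (divides k refl) =
  subst (λ n → p ∸ 1 ∣ φ n) (*-comm p k) (p∸1∣φ[p*m] p-prime k {{m*n≢0⇒m≢0 k}})

≡[mod]⇒∣∸ : b ≤ a → a ≡ b [mod n ] → n ∣ a ∸ b
≡[mod]⇒∣∸ {b} {a} b≤a n∣a-b =
  subst (_ ∣_) (cong ℤ.∣_∣ (trans (ℤ.[+m]-[+n]≡m⊖n a b) (ℤ.⊖-≥ b≤a))) n∣a-b

∣-≡[mod] : d ∣ n → a ≡ b [mod n ] → d ∣ b → d ∣ a
∣-≡[mod] {d} {n} {a} {b} d∣n n∣a-b d∣b =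
  Signed.∣⇒∣ᵤ {ℤ.+ d} {ℤ.+ a} (Signed.∣m+n∣n⇒∣m d∣a-b (Signed.∣m⇒∣-m d∣b′))
  where
  d∣a-b : ℤ.+ d Signed.∣ ℤ.+ a ℤ.- ℤ.+ b
  d∣a-b = Signed.∣-trans (Signed.∣ᵤ⇒∣ {ℤ.+ d} {ℤ.+ n} d∣n) (Signed.∣ᵤ⇒∣ {ℤ.+ n} n∣a-b)
  d∣b′ : ℤ.+ d Signed.∣ ℤ.+ b
  d∣b′ = Signed.∣ᵤ⇒∣ {ℤ.+ d} {ℤ.+ b} d∣b

p≡1[mod-q]∧p∣n⇒q∣φ[n] : ∀ {q} → Prime p → p ≡ 1 [mod q ] → p ∣ n → .{{NonZero n}} → q ∣ φ n
p≡1[mod-q]∧p∣n⇒q∣φ[n] {p} p-prime p≡1 p∣n =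
  ∣-trans (≡[mod]⇒∣∸ (>-nonZero⁻¹ p {{prime⇒nonZero p-prime}}) p≡1) (prime∣n⇒p∸1∣φ[n] p-prime p∣n)

F[1+m+n] : ∀ m n → F (suc (m + n)) ≡ F (suc m) * F (suc n) + F m * F n
F[1+m+n] zero          n = sym (trans (+-identityʳ (1 * F (suc n))) (*-identityˡ (F (suc n))))
F[1+m+n] (suc zero)    n = sym (cong₂ _+_ (*-identityˡ (F (suc n))) (*-identityˡ (F n)))
F[1+m+n] (suc (suc m)) n = trans (cong₂ _+_ (F[1+m+n] (suc m) n) (F[1+m+n] m n))
                                 (regroup (F (2 + m)) (F (suc m)) (F m) (F (suc n)) (F n))
  where
  regroup : ∀ a b c x y → (a * x + b * y) + (b * x + c * y) ≡ (a + b) * x + (b + c) * y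
  regroup = solve-∀

F[m]∣F[k*m] : ∀ k m → F m ∣ F (k * m)
F[m]∣F[k*m] zero    m       = F m ∣0
F[m]∣F[k*m] (suc k) zero    = F[m]∣F[k*m] k zero
F[m]∣F[k*m] (suc k) (suc m) = subst (F (suc m) ∣_) (sym (F[1+m+n] m (k * suc m)))
  (∣m∣n⇒∣m+n (m∣m*n _) (∣n⇒∣m*n (F m) (F[m]∣F[k*m] k (suc m))))

F-mono-∣ : m ∣ n → F m ∣ F n
F-mono-∣ {m} (divides k refl) = F[m]∣F[k*m] k m

F[1+n]>0 : ∀ n → F (suc n) > 0
F[1+n]>0 zero    = z<s
F[1+n]>0 (suc n) = ≤-trans (F[1+n]>0 n) (m≤m+n _ _)

theorem3p1 : (q : ℕ) → Prime q → ¬ (2 ∣ q) →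
    (P : ℕ) → IsPisanoPeriod q P →
    ((r : ℕ) →
      (∃ λ p → Prime p × p ≡ 1 [mod q ] ×
        (∃ λ z → IsRankOfApparition p z × z ∣ gcd r P)) →
      InS q P r)
    ×
    ((∃ λ p → Prime p × p ≡ 1 [mod q ] ×
        (∃ λ z → IsRankOfApparition p z × z ∣ P)) →
      ∃ λ r → r < P × InS q P r)
theorem3p1 q _ _ P (P>0 , _) =
  inS , λ (p , p-prime , p≡1 , z , rank , z∣P) →
    0 , P>0 , inS 0 (p , p-prime , p≡1 , z , rank , subst (z ∣_) (sym (gcd-identityˡ P)) z∣P)
  where
  inS : (r : ℕ) →
    (∃ λ p → Prime p × p ≡ 1 [mod q ] × (∃ λ z → IsRankOfApparition p z × z ∣ gcd r P)) →
    InS q P r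
  inS r (p , p-prime , p≡1 , z , (_ , p∣Fz , _) , z∣gcd) m@(suc m′) _ m≡r =
    p≡1[mod-q]∧p∣n⇒q∣φ[n] p-prime p≡1 (∣-trans p∣Fz (F-mono-∣ z∣m)) {{>-nonZero (F[1+n]>0 m′)}}
    where
    z∣m : z ∣ m
    z∣m = ∣-≡[mod] (∣-trans z∣gcd (gcd[m,n]∣n r P)) m≡r (∣-trans z∣gcd (gcd[m,n]∣m r P))
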